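{- Let $n\ge 2$ and let $V_n$ be the set of Schubert problems for $GL_n$, i.e. triples $(u,v,w)\in S_n^3$ with $l(u)+l(v)+l(w)=\binom n2$. Let $f:V_n\to\mathbb Z$ satisfy: (1) $f$ is invariant under descent-cycling: whenever $(u,v,w)\in S_n^3$ with $l(u)+l(v)+l(w)=\binom n2-1$ and $1\le i\le n-1$ are such that $u(i)<u(i+1)$, $v(i)<v(i+1)$, $w(i)<w(i+1)$, one has $f(us_i,v,w)=f(u,vs_i,w)=f(u,v,ws_i)$; (2) $f(u,v,w)=0$ whenever $(u,v,w)$ is dc-trivial, i.e. there is some $i$ with $u(i)<u(i+1)$, $v(i)<v(i+1)$ and $w(i)<w(i+1)$; (3) $f(\mathrm{id},\mathrm{id},w_0)=1$. Then $f$ obeys Monk's rule: let $\pi\in S_n$, let $\sigma'\in S_n$ be given by $\sigma'(m)=n+1-\pi(m)$, and let $\sigma$ be obtained from $\sigma'$ by exchanging the entries in two positions $j<k$ with $\sigma'(j)>\sigma'(k)$, such that $l(\sigma)=l(\sigma')-1$. Then for each $1\le i\le n-1$, $f(\pi,s_i,\sigma)=1$ if $j\le i<k$, and $f(\pi,s_i,\sigma)=0$ otherwise.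
   Context: $l(w)$ is the number of inversions of $w\in S_n$, $w_0$ is the longest permutation $w_0(m)=n+1-m$, $\mathrm{id}$ is the identity, $s_i$ is the transposition $i\leftrightarrow i+1$, and $us_i$ denotes $u$ with its entries in positions $i$ and $i+1$ exchanged. -}

module Defs where

open import Data.Bool using (Bool; T; _∧_; true)
open import Data.Nat using (ℕ; _+_; _≡ᵇ_)
open import Data.Nat.Combinatorics using (_C_)
open import Data.Fin using (Fin; opposite) renaming (_<_ to _<ᶠ_; _<?_ to _<ᶠ?_)
open import Data.Fin.Properties using (_≟_)
open import Data.Vec using (Vec; lookup; tabulate; allFin; count; _[_]≔_; sum; foldr)
open import Data.Product using (_×_)
open import Relation.Nullary using (does; _×-dec_)
open import Relation.Binary.PropositionalEquality using (_≡_)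

-- Permutations of {1..n} in one-line notation, shifted to 0-based:
-- positions and values are both elements of Fin n; v is a permutation
-- iff every value k occurs exactly once in v.
isPermᵇ : ∀ {n} → Vec (Fin n) n → Bool
isPermᵇ {n} v = foldr _ (λ k b → (count (k ≟_) v ≡ᵇ 1) ∧ b) true (allFin n)

IsPerm : ∀ {n} → Vec (Fin n) n → Set
IsPerm v = T (isPermᵇ v)

inversions : ∀ {n} → Vec (Fin n) n → ℕ
inversions {n} v =
  sum (tabulate λ a → count (λ b → (a <ᶠ? b) ×-dec (lookup v b <ᶠ? lookup v a)) (allFin n))

swapPos : ∀ {n} {A : Set} → Vec A n → Fin n → Fin n → Vec A n
swapPos v a b = (v [ a ]≔ lookup v b) [ b ]≔ lookup v a

-- identity and longest element w0 (w0(m) = n+1-m, i.e. 0-based n-1-m)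
idPerm : ∀ n → Vec (Fin n) n
idPerm n = allFin n

w₀ : ∀ n → Vec (Fin n) n
w₀ n = tabulate opposite

-- the simple transposition s_i exchanging adjacent positions a, b (b = a+1)
sPerm : ∀ {n} → Fin n → Fin n → Vec (Fin n) n
sPerm {n} a b = swapPos (idPerm n) a b

Ascent : ∀ {n} → Vec (Fin n) n → Fin n → Fin n → Set
Ascent u a b = lookup u a <ᶠ lookup u b

record SchubertProblem (n : ℕ) : Set where
  constructor sp
  field
    u v w : Vec (Fin n) n
    u-perm : IsPerm u
    v-perm : IsPerm v
    w-perm : IsPerm w
    length-sum : inversions u + inversions v + inversions w ≡ n C 2
open SchubertProblem public

-- Descent cycling at an adjacent position i moves a simple transposition s_i between two of the
-- three slots of a Schubert problem. At a descent of π it gives f(π, id, w₀π) = f(πs_i, id, w₀πs_i),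
-- so by induction on l(π) and normalisation f(π, id, w₀π) = 1.
-- For Monk's rule write σ = σ′·(j k) with σ′ = w₀π, and induct on k − j. Since l(σ) = l(σ′) − 1,
-- no position strictly between j and k carries a σ′-value strictly between σ′(k) and σ′(j); hence
-- at the adjacent pair (j, j+1) (if j ≠ a) or (k−1, k) (if j = a) the permutations π and σ are in
-- opposite order, and cycling that pair through the first and third slot yields a problem of the
-- same shape whose interval is one shorter and contains a exactly when [j, k) does. For k = j + 1
-- the problem is dc-trivial at j unless j = a, and for j = a cycling s_a from the second into the
-- third slot leaves (π, id, σ′) = (π, id, w₀π).

module Submission where

open import Defs
import Data.Nat as ℕ
open import Data.Nat using (_≡ᵇ_; ℕ; zero; suc; _+_; _≤_; _<_; z≤n; s≤s; s<s⁻¹; _∸_)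
open import Data.Nat.Properties hiding (_≟_)
open import Data.Fin using (Fin; zero; suc; toℕ; fromℕ<; opposite) renaming (_<_ to _<ᶠ_; _<?_ to _<ᶠ?_; _≤_ to _≤ᶠ_)
open import Data.Fin.Properties
  using (_≟_; toℕ-injective; toℕ<n; toℕ-fromℕ<; opposite-prop; opposite-involutive; any?)
  renaming (suc-injective to fsuc-injective)
open import Data.Fin.Permutation using () renaming (transpose to transposition)
open import Data.Fin.Permutation.Components using (transpose; transpose-inverse)
open import Data.Vec using (Vec; lookup; tabulate; allFin; count; _[_]≔_; foldr)
import Data.Vec as Vec
open import Data.Vec.Properties using (lookup∘update; lookup∘update′; tabulate∘lookup; tabulate-cong; lookup∘tabulate)
open import Data.Bool using (Bool; T; _∧_; true)
open import Data.Bool.Properties using (T-∧)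
open import Data.Unit using (tt)
open import Data.Product using (_×_; _,_; proj₁; proj₂; ∃-syntax)
open import Data.Sum using (_⊎_; inj₁; inj₂) renaming (map to ⊎-map)
open import Data.Integer using (ℤ; 0ℤ; 1ℤ)
open import Data.Nat.Combinatorics using (_C_)
open import Algebra.Properties.CommutativeSemigroup +-commutativeSemigroup using (xy∙z≈xz∙y; x∙yz≈xz∙y)
open import Function.Bundles using (Equivalence)
open import Data.Empty using (⊥-elim)
open import Relation.Nullary using (Dec; yes; no; ¬_; _×-dec_)
open import Relation.Nullary.Decidable using (dec-true; dec-false)
open import Relation.Binary.PropositionalEquality
open import Relation.Binary.Definitions using (tri<; tri≈; tri>)
open import Induction.WellFounded using (Acc; acc)
open import Data.Nat.Induction using (<-wellFounded)
open import Function using (_∘_)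
open import Algebra.Properties.CommutativeMonoid.Sum +-0-commutativeMonoid using (sum; sum-cong-≗; sum-permute)

indicator : ∀ {p} {P : Set p} → Dec P → ℕ
indicator (yes _) = 1
indicator (no _)  = 0

indicator-yes : ∀ {p} {P : Set p} (d : Dec P) → P → indicator d ≡ 1
indicator-yes (yes _) _ = refl
indicator-yes (no ¬p) p = ⊥-elim (¬p p)

indicator-no : ∀ {p} {P : Set p} (d : Dec P) → ¬ P → indicator d ≡ 0
indicator-no (yes p) ¬p = ⊥-elim (¬p p)
indicator-no (no _)  _  = refl

indicator-cong : ∀ {p q} {P : Set p} {Q : Set q} (d : Dec P) (e : Dec Q) → (P → Q) → (Q → P) →
                 indicator d ≡ indicator e
indicator-cong (yes _) (yes _) _ _ = refl
indicator-cong (yes p) (no ¬q) f _ = ⊥-elim (¬q (f p))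
indicator-cong (no ¬p) (yes q) _ g = ⊥-elim (¬p (g q))
indicator-cong (no _)  (no _)  _ _ = refl

sum-suc-at : ∀ {n} {h h′ : Fin n → ℕ} (i : Fin n) → (∀ c → c ≢ i → h c ≡ h′ c) → h i ≡ suc (h′ i) →
             sum h ≡ suc (sum h′)
sum-suc-at {suc n} zero    h≡h′ hi = cong₂ _+_ hi (sum-cong-≗ (λ c → h≡h′ (suc c) λ ()))
sum-suc-at {suc n} {h} {h′} (suc i) h≡h′ hi =
  trans (cong₂ _+_ (h≡h′ zero λ ()) (sum-suc-at i (λ c c≢i → h≡h′ (suc c) (c≢i ∘ fsuc-injective)) hi))
        (+-suc (h′ zero) _)

≤-sum : ∀ {n} (h : Fin n → ℕ) i → h i ≤ sum h
≤-sum h zero    = m≤m+n _ _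
≤-sum h (suc i) = ≤-trans (≤-sum (h ∘ suc) i) (m≤n+m _ _)

+-≤-sum : ∀ {n} (h : Fin n → ℕ) {i j} → i ≢ j → h i + h j ≤ sum h
+-≤-sum h {zero}  {zero}  i≢j = ⊥-elim (i≢j refl)
+-≤-sum h {zero}  {suc j} _   = +-monoʳ-≤ (h zero) (≤-sum (h ∘ suc) j)
+-≤-sum h {suc i} {zero}  _   = subst (_≤ sum h) (+-comm (h zero) _) (+-monoʳ-≤ (h zero) (≤-sum (h ∘ suc) i))
+-≤-sum h {suc i} {suc j} i≢j = ≤-trans (+-≤-sum (h ∘ suc) (i≢j ∘ cong suc)) (m≤n+m _ _)

sum-transpose : ∀ {n} (i j : Fin n) (h : Fin n → ℕ) → sum (h ∘ transpose i j) ≡ sum h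
sum-transpose i j h = sym (sum-permute h (transposition i j))

transpose-matchˡ : ∀ {n} (i j : Fin n) → transpose i j i ≡ j
transpose-matchˡ i j rewrite dec-true (i ≟ i) refl = refl

transpose-matchʳ : ∀ {n} (i j : Fin n) → transpose i j j ≡ i
transpose-matchʳ i j with j ≟ i
... | yes refl = refl
... | no j≢i rewrite dec-true (j ≟ j) refl = refl

transpose-other : ∀ {n} {i j k : Fin n} → k ≢ i → k ≢ j → transpose i j k ≡ k
transpose-other {i = i} {j} {k} k≢i k≢j rewrite dec-false (k ≟ i) k≢i | dec-false (k ≟ j) k≢j = refl

transpose-sym : ∀ {n} (i j k : Fin n) → transpose i j k ≡ transpose j i k
transpose-sym i j k = cases (k ≟ i) (k ≟ j)
  where
  cases : Dec (k ≡ i) → Dec (k ≡ j) → transpose i j k ≡ transpose j i k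
  cases (yes refl) _          = trans (transpose-matchˡ k j) (sym (transpose-matchʳ j k))
  cases (no _)     (yes refl) = trans (transpose-matchʳ i k) (sym (transpose-matchˡ k i))
  cases (no k≢i)   (no k≢j)   = trans (transpose-other k≢i k≢j) (sym (transpose-other k≢j k≢i))

transpose-involutive : ∀ {n} (i j k : Fin n) → transpose i j (transpose i j k) ≡ k
transpose-involutive i j k = trans (cong (transpose i j) (transpose-sym i j k)) (transpose-inverse i j)

transpose-conj : ∀ {n} {x y z : Fin n} → x ≢ y → y ≢ z → x ≢ z →
                 ∀ c → transpose x y (transpose y z (transpose x y c)) ≡ transpose x z c
transpose-conj {x = x} {y} {z} x≢y y≢z x≢z c = cases (c ≟ x) (c ≟ y) (c ≟ z)
  where
  open ≡-Reasoning
  cases : Dec (c ≡ x) → Dec (c ≡ y) → Dec (c ≡ z) →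
          transpose x y (transpose y z (transpose x y c)) ≡ transpose x z c
  cases (yes refl) _ _ = begin
    transpose c y (transpose y z (transpose c y c)) ≡⟨ cong (transpose c y ∘ transpose y z) (transpose-matchˡ c y) ⟩
    transpose c y (transpose y z y)                 ≡⟨ cong (transpose c y) (transpose-matchˡ y z) ⟩
    transpose c y z                                 ≡⟨ transpose-other (x≢z ∘ sym) (y≢z ∘ sym) ⟩
    z                                               ≡⟨ transpose-matchˡ c z ⟨
    transpose c z c                                 ∎
  cases (no _) (yes refl) _ = begin
    transpose x c (transpose c z (transpose x c c)) ≡⟨ cong (transpose x c ∘ transpose c z) (transpose-matchʳ x c) ⟩
    transpose x c (transpose c z x)                 ≡⟨ cong (transpose x c) (transpose-other x≢y x≢z) ⟩
    transpose x c x                                 ≡⟨ transpose-matchˡ x c ⟩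
    c                                               ≡⟨ transpose-other (x≢y ∘ sym) y≢z ⟨
    transpose x z c                                 ∎
  cases (no _) (no _) (yes refl) = begin
    transpose x y (transpose y c (transpose x y c)) ≡⟨ cong (transpose x y ∘ transpose y c)
                                                            (transpose-other (x≢z ∘ sym) (y≢z ∘ sym)) ⟩
    transpose x y (transpose y c c)                 ≡⟨ cong (transpose x y) (transpose-matchʳ y c) ⟩
    transpose x y y                                 ≡⟨ transpose-matchʳ x y ⟩
    x                                               ≡⟨ transpose-matchʳ x c ⟨
    transpose x c c                                 ∎
  cases (no c≢x) (no c≢y) (no c≢z) = begin
    transpose x y (transpose y z (transpose x y c)) ≡⟨ cong (transpose x y ∘ transpose y z) (transpose-other c≢x c≢y) ⟩
    transpose x y (transpose y z c)                 ≡⟨ cong (transpose x y) (transpose-other c≢y c≢z) ⟩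
    transpose x y c                                 ≡⟨ transpose-other c≢x c≢y ⟩
    c                                               ≡⟨ transpose-other c≢x c≢z ⟨
    transpose x z c                                 ∎

transpose-slide : ∀ {n} {x y z : Fin n} → x ≢ y → y ≢ z → x ≢ z →
                  ∀ c → transpose x z (transpose x y c) ≡ transpose x y (transpose y z c)
transpose-slide {x = x} {y} {z} x≢y y≢z x≢z c =
  trans (sym (transpose-conj x≢y y≢z x≢z (transpose x y c)))
        (cong (transpose x y ∘ transpose y z) (transpose-involutive x y c))

Adjacent : ∀ {n} → Fin n → Fin n → Set
Adjacent a b = suc (toℕ a) ≡ toℕ b

adjacent-< : ∀ {n} {a b : Fin n} → Adjacent a b → a <ᶠ b
adjacent-< ab = subst (_ <_) ab (n<1+n _)

adjacent-≢ : ∀ {n} {a b : Fin n} → Adjacent a b → a ≢ b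
adjacent-≢ ab refl = <-irrefl refl (adjacent-< ab)

adjacent-unique : ∀ {n} {a b c : Fin n} → Adjacent a b → Adjacent a c → b ≡ c
adjacent-unique ab ac = toℕ-injective (trans (sym ab) ac)

<ᶠ⇒≢ : ∀ {n} {c d : Fin n} → c <ᶠ d → c ≢ d
<ᶠ⇒≢ c<d refl = <-irrefl refl c<d

transpose-adjacent-< : ∀ {n} {a b c d : Fin n} → Adjacent a b → ¬ (c ≡ a × d ≡ b) → ¬ (c ≡ b × d ≡ a) →
                       c <ᶠ d → transpose a b c <ᶠ transpose a b d
transpose-adjacent-< {a = a} {b} {c} {d} ab ¬ab ¬ba c<d = cases (c ≟ a) (c ≟ b) (d ≟ a) (d ≟ b)
  where
  cases : Dec (c ≡ a) → Dec (c ≡ b) → Dec (d ≡ a) → Dec (d ≡ b) → transpose a b c <ᶠ transpose a b d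
  cases (yes refl) _ (yes refl) _ = ⊥-elim (<-irrefl refl c<d)
  cases (yes refl) _ (no _) (yes refl) = ⊥-elim (¬ab (refl , refl))
  cases (yes refl) _ (no d≢a) (no d≢b) rewrite transpose-matchˡ c b | transpose-other d≢a d≢b =
    subst (_< toℕ d) ab (≤∧≢⇒< c<d λ e → d≢b (toℕ-injective (trans (sym e) ab)))
  cases (no _) (yes refl) (yes refl) _ = ⊥-elim (¬ba (refl , refl))
  cases (no _) (yes refl) (no _) (yes refl) = ⊥-elim (<-irrefl refl c<d)
  cases (no _) (yes refl) (no d≢a) (no d≢b) rewrite transpose-matchʳ a c | transpose-other d≢a d≢b =
    <-trans (adjacent-< ab) c<d
  cases (no c≢a) (no c≢b) (yes refl) _ rewrite transpose-matchˡ d b | transpose-other c≢a c≢b =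
    <-trans c<d (adjacent-< ab)
  cases (no c≢a) (no c≢b) (no _) (yes refl) rewrite transpose-matchʳ a d | transpose-other c≢a c≢b =
    ≤∧≢⇒< (≤-pred (subst (toℕ c <_) (sym ab) c<d)) (c≢a ∘ toℕ-injective)
  cases (no c≢a) (no c≢b) (no d≢a) (no d≢b) rewrite transpose-other c≢a c≢b | transpose-other d≢a d≢b = c<d

transpose-adjacent-<⁻ : ∀ {n} {a b c d : Fin n} → Adjacent a b → ¬ (c ≡ a × d ≡ b) → ¬ (c ≡ b × d ≡ a) →
                        transpose a b c <ᶠ transpose a b d → c <ᶠ d
transpose-adjacent-<⁻ {a = a} {b} {c} {d} ab ¬ab ¬ba τc<τd =
  subst₂ _<ᶠ_ (transpose-involutive a b c) (transpose-involutive a b d)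
    (transpose-adjacent-< ab
      (λ (τc≡a , τd≡b) → ¬ba (moved τc≡a (transpose-matchˡ a b) , moved τd≡b (transpose-matchʳ a b)))
      (λ (τc≡b , τd≡a) → ¬ab (moved τc≡b (transpose-matchʳ a b) , moved τd≡a (transpose-matchˡ a b)))
      τc<τd)
  where
  moved : ∀ {x y z} → transpose a b x ≡ y → transpose a b y ≡ z → x ≡ z
  moved {x} refl τy≡z = trans (sym (transpose-involutive a b x)) τy≡z

inversion : ∀ {n} → (Fin n → Fin n) → Fin n → Fin n → ℕ
inversion g c d = indicator ((c <ᶠ? d) ×-dec (g d <ᶠ? g c))

inversionsᶠ : ∀ {n} → (Fin n → Fin n) → ℕ
inversionsᶠ g = sum λ c → sum λ d → inversion g c d

inversionsᶠ-cong : ∀ {n} {g h : Fin n → Fin n} → (∀ c → g c ≡ h c) → inversionsᶠ g ≡ inversionsᶠ h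
inversionsᶠ-cong {g = g} {h} g≗h = sum-cong-≗ λ c → sum-cong-≗ λ d → at c d (g≗h c) (g≗h d)
  where
  at : ∀ c d → g c ≡ h c → g d ≡ h d → inversion g c d ≡ inversion h c d
  at c d gc≡hc gd≡hd rewrite gc≡hc | gd≡hd = refl

-- Reindexing both sums by (a b), the indicators for g ∘ (a b) and for g agree except at the
-- pair (b, a), which the swap turns into an inversion.
inversionsᶠ-swap-ascent : ∀ {n} {g : Fin n → Fin n} {a b : Fin n} → Adjacent a b → g a <ᶠ g b →
                          inversionsᶠ (g ∘ transpose a b) ≡ suc (inversionsᶠ g)
inversionsᶠ-swap-ascent {g = g} {a} {b} ab ga<gb = begin
  inversionsᶠ (g ∘ transpose a b)               ≡⟨ reindex ⟩
  sum (λ c → sum (λ d → inversionAfter c d))    ≡⟨ sum-suc-at b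
                                                     (λ c c≢b → sum-cong-≗ λ d → agree {c} {d} (c≢b ∘ proj₁))
                                                     (sum-suc-at a (λ d d≢a → agree {b} {d} (d≢a ∘ proj₂)) new) ⟩
  suc (inversionsᶠ g)                           ∎
  where
  open ≡-Reasoning
  τ = transpose a b
  inversionAfter : Fin _ → Fin _ → ℕ
  inversionAfter c d = indicator ((τ c <ᶠ? τ d) ×-dec (g d <ᶠ? g c))

  reindex : inversionsᶠ (g ∘ τ) ≡ sum (λ c → sum (λ d → inversionAfter c d))
  reindex = trans (sym (sum-transpose a b _)) (sum-cong-≗ λ c → trans (sym (sum-transpose a b _)) (sum-cong-≗ λ d →
    subst₂ (λ x y → indicator ((τ c <ᶠ? τ d) ×-dec (g y <ᶠ? g x)) ≡ inversionAfter c d)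
           (sym (transpose-involutive a b c)) (sym (transpose-involutive a b d)) refl))

  agree : ∀ {c d} → ¬ (c ≡ b × d ≡ a) → inversionAfter c d ≡ inversion g c d
  agree {c} {d} ¬ba = cases (c ≟ a) (d ≟ b)
    where
    cases : Dec (c ≡ a) → Dec (d ≡ b) → inversionAfter c d ≡ inversion g c d
    cases (yes refl) (yes refl) =
      trans (indicator-no _ λ (τc<τd , _) →
               <-asym (subst₂ _<ᶠ_ (transpose-matchˡ c d) (transpose-matchʳ c d) τc<τd) (adjacent-< ab))
            (sym (indicator-no _ λ (_ , gd<gc) → <-asym gd<gc ga<gb))
    cases (no c≢a) _ = indicator-cong _ _
      (λ (τc<τd , gd<gc) → transpose-adjacent-<⁻ ab (c≢a ∘ proj₁) ¬ba τc<τd , gd<gc)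
      (λ (c<d , gd<gc) → transpose-adjacent-< ab (c≢a ∘ proj₁) ¬ba c<d , gd<gc)
    cases _ (no d≢b) = indicator-cong _ _
      (λ (τc<τd , gd<gc) → transpose-adjacent-<⁻ ab (d≢b ∘ proj₂) ¬ba τc<τd , gd<gc)
      (λ (c<d , gd<gc) → transpose-adjacent-< ab (d≢b ∘ proj₂) ¬ba c<d , gd<gc)

  new : inversionAfter b a ≡ suc (inversion g b a)
  new = trans (indicator-yes _ (subst₂ _<ᶠ_ (sym (transpose-matchʳ a b)) (sym (transpose-matchˡ a b)) (adjacent-< ab) , ga<gb))
              (cong suc (sym (indicator-no _ λ (b<a , _) → <-asym b<a (adjacent-< ab))))

inversionsᶠ-swap-adjacent-descent : ∀ {n} {g : Fin n → Fin n} {a b : Fin n} → Adjacent a b → g b <ᶠ g a →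
                                    inversionsᶠ g ≡ suc (inversionsᶠ (g ∘ transpose a b))
inversionsᶠ-swap-adjacent-descent {g = g} {a} {b} ab gb<ga = begin
  inversionsᶠ g                                       ≡⟨ inversionsᶠ-cong (cong g ∘ transpose-involutive a b) ⟨
  inversionsᶠ (g ∘ transpose a b ∘ transpose a b)     ≡⟨ inversionsᶠ-swap-ascent ab
                                                           (subst₂ _<ᶠ_ (cong g (sym (transpose-matchˡ a b)))
                                                                        (cong g (sym (transpose-matchʳ a b))) gb<ga) ⟩
  suc (inversionsᶠ (g ∘ transpose a b))               ∎
  where open ≡-Reasoning

inversionsᶠ-swap-equal : ∀ {n} {g : Fin n → Fin n} {a b : Fin n} → g a ≡ g b →
                         inversionsᶠ (g ∘ transpose a b) ≡ inversionsᶠ g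
inversionsᶠ-swap-equal {g = g} {a} {b} ga≡gb = inversionsᶠ-cong λ c → cases c (c ≟ a) (c ≟ b)
  where
  cases : ∀ c → Dec (c ≡ a) → Dec (c ≡ b) → g (transpose a b c) ≡ g c
  cases c (yes refl) _          = trans (cong g (transpose-matchˡ c b)) (sym ga≡gb)
  cases c (no _)     (yes refl) = trans (cong g (transpose-matchʳ a c)) ga≡gb
  cases c (no c≢a)   (no c≢b)   = cong g (transpose-other c≢a c≢b)

inversionsᶠ-swap-adjacent-≤ : ∀ {n} (g : Fin n → Fin n) {a b : Fin n} → Adjacent a b →
                              inversionsᶠ (g ∘ transpose a b) ≤ suc (inversionsᶠ g)
inversionsᶠ-swap-adjacent-≤ g {a} {b} ab with <-cmp (toℕ (g a)) (toℕ (g b))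
... | tri< ga<gb _ _ = ≤-reflexive (inversionsᶠ-swap-ascent ab ga<gb)
... | tri≈ _ ga≡gb _ = m≤n⇒m≤1+n (≤-reflexive (inversionsᶠ-swap-equal (toℕ-injective ga≡gb)))
... | tri> _ _ gb<ga = ≤-trans (n≤1+n _) (m≤n⇒m≤1+n (≤-reflexive (sym (inversionsᶠ-swap-adjacent-descent ab gb<ga))))

inversionsᶠ-swap-descent : ∀ {n} {g : Fin n → Fin n} {j k : Fin n} → j <ᶠ k → g k <ᶠ g j →
                           inversionsᶠ (g ∘ transpose j k) < inversionsᶠ g
inversionsᶠ-swap-descent {n} {j = j} {k} j<k = by-distance (toℕ k ∸ suc (toℕ j)) (sym (m∸n+n≡m j<k))
  where
  by-distance : ∀ d {g : Fin n → Fin n} {j k : Fin n} → toℕ k ≡ d + suc (toℕ j) → g k <ᶠ g j →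
                inversionsᶠ (g ∘ transpose j k) < inversionsᶠ g
  by-distance zero    k≡1+j gk<gj = ≤-reflexive (sym (inversionsᶠ-swap-adjacent-descent (sym k≡1+j) gk<gj))
  -- (j k) = (j q)(q k)(j q) with q = j + 1, and the inner (q k) is handled by induction
  by-distance (suc d) {g} {j} {k} k≡d+2+j gk<gj = cases (g q <ᶠ? g j)
    where
    2+j≤k : suc (suc (toℕ j)) ≤ toℕ k
    2+j≤k = subst (_ ≤_) (sym k≡d+2+j) (s≤s (m≤n+m _ d))
    q = fromℕ< (<-trans 2+j≤k (toℕ<n k))
    jq : Adjacent j q
    jq = sym (toℕ-fromℕ< _)
    q<k : q <ᶠ k
    q<k = subst (_< toℕ k) jq 2+j≤k
    j≢k : j ≢ k
    j≢k = <ᶠ⇒≢ (<-trans (adjacent-< jq) q<k)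
    k≢q : k ≢ q
    k≢q = <ᶠ⇒≢ q<k ∘ sym
    g₁ = g ∘ transpose j q
    h = g₁ ∘ transpose q k
    h-j : h j ≡ g q
    h-j = trans (cong g₁ (transpose-other (adjacent-≢ jq) j≢k)) (cong g (transpose-matchˡ j q))
    h-q : h q ≡ g k
    h-q = trans (cong g₁ (transpose-matchˡ q k)) (cong g (transpose-other (j≢k ∘ sym) k≢q))
    IH : inversionsᶠ h < inversionsᶠ g₁
    IH = by-distance d (trans k≡d+2+j (trans (sym (+-suc d _)) (cong (λ m → d + suc m) jq)))
           (subst₂ _<ᶠ_ (cong g (sym (transpose-other (j≢k ∘ sym) k≢q))) (cong g (sym (transpose-matchʳ j q))) gk<gj)
    reassociate : inversionsᶠ (g ∘ transpose j k) ≡ inversionsᶠ (h ∘ transpose j q)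
    reassociate = inversionsᶠ-cong (cong g ∘ sym ∘ transpose-conj (adjacent-≢ jq) (<ᶠ⇒≢ q<k) j≢k)
    open ≤-Reasoning
    cases : Dec (g q <ᶠ g j) → inversionsᶠ (g ∘ transpose j k) < inversionsᶠ g
    cases (yes gq<gj) = begin-strict
      inversionsᶠ (g ∘ transpose j k)  ≡⟨ reassociate ⟩
      inversionsᶠ (h ∘ transpose j q)  ≤⟨ inversionsᶠ-swap-adjacent-≤ h jq ⟩
      suc (inversionsᶠ h)              ≤⟨ IH ⟩
      inversionsᶠ g₁                   <⟨ n<1+n _ ⟩
      suc (inversionsᶠ g₁)             ≡⟨ inversionsᶠ-swap-adjacent-descent jq gq<gj ⟨
      inversionsᶠ g                    ∎
    cases (no gq≮gj) = s<s⁻¹ (begin-strict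
      suc (inversionsᶠ (g ∘ transpose j k))  ≡⟨ cong suc reassociate ⟩
      suc (inversionsᶠ (h ∘ transpose j q))  ≡⟨ inversionsᶠ-swap-adjacent-descent jq hq<hj ⟨
      inversionsᶠ h                          <⟨ IH ⟩
      inversionsᶠ g₁                         ≤⟨ inversionsᶠ-swap-adjacent-≤ g jq ⟩
      suc (inversionsᶠ g)                    ∎)
      where
      hq<hj : h q <ᶠ h j
      hq<hj = subst₂ _<ᶠ_ (sym h-q) (sym h-j) (<-≤-trans gk<gj (≮⇒≥ gq≮gj))

inversionsᶠ-swap-decrease⇒descent : ∀ {n} {g : Fin n → Fin n} {j k : Fin n} → j <ᶠ k →
                                    inversionsᶠ (g ∘ transpose j k) < inversionsᶠ g → g k <ᶠ g j
inversionsᶠ-swap-decrease⇒descent {g = g} {j} {k} j<k decrease with <-cmp (toℕ (g k)) (toℕ (g j))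
... | tri< gk<gj _ _ = gk<gj
... | tri≈ _ gk≡gj _ = ⊥-elim (<-irrefl (inversionsᶠ-swap-equal (toℕ-injective (sym gk≡gj))) decrease)
... | tri> _ _ gj<gk = ⊥-elim (<-asym decrease increase)
  where
  increase : inversionsᶠ g < inversionsᶠ (g ∘ transpose j k)
  increase = subst (_< inversionsᶠ (g ∘ transpose j k)) (inversionsᶠ-cong (cong g ∘ transpose-involutive j k))
    (inversionsᶠ-swap-descent {g = g ∘ transpose j k} j<k
      (subst₂ _<ᶠ_ (cong g (sym (transpose-matchʳ j k))) (cong g (sym (transpose-matchˡ j k))) gj<gk))

inversionsᶠ-swap-over-middle : ∀ {n} {g : Fin n → Fin n} {j q k : Fin n} → j <ᶠ q → q <ᶠ k →
                               g k <ᶠ g q → g q <ᶠ g j → 2 + inversionsᶠ (g ∘ transpose j k) < inversionsᶠ g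
inversionsᶠ-swap-over-middle {g = g} {j} {q} {k} j<q q<k gk<gq gq<gj = begin-strict
  2 + inversionsᶠ (g ∘ transpose j k)  ≡⟨ cong (2 +_) (inversionsᶠ-cong (cong g ∘ sym ∘ transpose-conj j≢q q≢k j≢k)) ⟩
  2 + inversionsᶠ (g₂ ∘ transpose j q) ≤⟨ s≤s (inversionsᶠ-swap-descent j<q g₂q<g₂j) ⟩
  suc (inversionsᶠ g₂)                 ≤⟨ inversionsᶠ-swap-descent q<k g₁k<g₁q ⟩
  inversionsᶠ g₁                       <⟨ inversionsᶠ-swap-descent j<q gq<gj ⟩
  inversionsᶠ g                        ∎
  where
  open ≤-Reasoning
  j≢q = <ᶠ⇒≢ j<q
  q≢k = <ᶠ⇒≢ q<k
  j≢k = <ᶠ⇒≢ (<-trans j<q q<k)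
  g₁ = g ∘ transpose j q
  g₂ = g₁ ∘ transpose q k
  g₁k<g₁q : g₁ k <ᶠ g₁ q
  g₁k<g₁q = subst₂ _<ᶠ_ (cong g (sym (transpose-other (j≢k ∘ sym) (q≢k ∘ sym))))
                        (cong g (sym (transpose-matchʳ j q))) gk<gj
    where gk<gj = <-trans gk<gq gq<gj
  g₂q<g₂j : g₂ q <ᶠ g₂ j
  g₂q<g₂j = subst₂ _<ᶠ_ (sym (trans (cong g₁ (transpose-matchˡ q k)) (cong g (transpose-other (j≢k ∘ sym) (q≢k ∘ sym)))))
                        (sym (trans (cong g₁ (transpose-other j≢q j≢k)) (cong g (transpose-matchˡ j q)))) gk<gq

lookup-swapPos : ∀ {n} {A : Set} (v : Vec A n) (a b c : Fin n) → lookup (swapPos v a b) c ≡ lookup v (transpose a b c)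
lookup-swapPos v a b c = cases (c ≟ b) (c ≟ a)
  where
  open ≡-Reasoning
  cases : Dec (c ≡ b) → Dec (c ≡ a) → lookup (swapPos v a b) c ≡ lookup v (transpose a b c)
  cases (yes refl) _ = begin
    lookup (swapPos v a c) c ≡⟨ lookup∘update c (v [ a ]≔ lookup v c) (lookup v a) ⟩
    lookup v a               ≡⟨ cong (lookup v) (transpose-matchʳ a c) ⟨
    lookup v (transpose a c c) ∎
  cases (no c≢b) (yes refl) = begin
    lookup (swapPos v c b) c ≡⟨ lookup∘update′ c≢b (v [ c ]≔ lookup v b) (lookup v c) ⟩
    lookup (v [ c ]≔ lookup v b) c ≡⟨ lookup∘update c v (lookup v b) ⟩
    lookup v b               ≡⟨ cong (lookup v) (transpose-matchˡ c b) ⟨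
    lookup v (transpose c b c) ∎
  cases (no c≢b) (no c≢a) = begin
    lookup (swapPos v a b) c       ≡⟨ lookup∘update′ c≢b (v [ a ]≔ lookup v b) (lookup v a) ⟩
    lookup (v [ a ]≔ lookup v b) c ≡⟨ lookup∘update′ c≢a v (lookup v b) ⟩
    lookup v c                     ≡⟨ cong (lookup v) (transpose-other c≢a c≢b) ⟨
    lookup v (transpose a b c)     ∎

≗⇒≡ : ∀ {n} {A : Set} {v v′ : Vec A n} → (∀ c → lookup v c ≡ lookup v′ c) → v ≡ v′
≗⇒≡ {v = v} {v′} eq = trans (sym (tabulate∘lookup v)) (trans (tabulate-cong eq) (tabulate∘lookup v′))

swapPos-involutive : ∀ {n} {A : Set} (v : Vec A n) a b → swapPos (swapPos v a b) a b ≡ v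
swapPos-involutive v a b = ≗⇒≡ λ c → trans (lookup-swapPos (swapPos v a b) a b c)
  (trans (lookup-swapPos v a b (transpose a b c)) (cong (lookup v) (transpose-involutive a b c)))

swapPos-slide : ∀ {n} {A : Set} (v : Vec A n) {j k c d j′ k′ : Fin n} →
                (∀ x → transpose j k (transpose c d x) ≡ transpose c d (transpose j′ k′ x)) →
                swapPos (swapPos v c d) j′ k′ ≡ swapPos (swapPos v j k) c d
swapPos-slide v {j} {k} {c} {d} {j′} {k′} slide = ≗⇒≡ λ x → begin
  lookup (swapPos (swapPos v c d) j′ k′) x      ≡⟨ lookup-swapPos (swapPos v c d) j′ k′ x ⟩
  lookup (swapPos v c d) (transpose j′ k′ x)    ≡⟨ lookup-swapPos v c d _ ⟩
  lookup v (transpose c d (transpose j′ k′ x))  ≡⟨ cong (lookup v) (slide x) ⟨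
  lookup v (transpose j k (transpose c d x))    ≡⟨ lookup-swapPos v j k _ ⟨
  lookup (swapPos v j k) (transpose c d x)      ≡⟨ lookup-swapPos (swapPos v j k) c d x ⟨
  lookup (swapPos (swapPos v j k) c d) x        ∎
  where open ≡-Reasoning

lookup-swapPos-matchˡ : ∀ {n} {A : Set} (v : Vec A n) a b → lookup (swapPos v a b) a ≡ lookup v b
lookup-swapPos-matchˡ v a b = trans (lookup-swapPos v a b a) (cong (lookup v) (transpose-matchˡ a b))

lookup-swapPos-matchʳ : ∀ {n} {A : Set} (v : Vec A n) a b → lookup (swapPos v a b) b ≡ lookup v a
lookup-swapPos-matchʳ v a b = trans (lookup-swapPos v a b b) (cong (lookup v) (transpose-matchʳ a b))

lookup-swapPos-other : ∀ {n} {A : Set} (v : Vec A n) {a b c} → c ≢ a → c ≢ b → lookup (swapPos v a b) c ≡ lookup v c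
lookup-swapPos-other v {a} {b} {c} c≢a c≢b = trans (lookup-swapPos v a b c) (cong (lookup v) (transpose-other c≢a c≢b))

swapPos-ascent : ∀ {n} (v : Vec (Fin n) n) {a b} → Ascent v b a → Ascent (swapPos v a b) a b
swapPos-ascent v {a} {b} = subst₂ _<ᶠ_ (sym (lookup-swapPos-matchˡ v a b)) (sym (lookup-swapPos-matchʳ v a b))

ascent-≡ : ∀ {n} {x y : Vec (Fin n) n} {a b} → x ≡ y → Ascent y a b → Ascent x a b
ascent-≡ refl asc = asc

sum-tabulate : ∀ {n} (h : Fin n → ℕ) → Vec.sum (tabulate h) ≡ sum h
sum-tabulate {zero}  h = refl
sum-tabulate {suc n} h = cong (h zero +_) (sum-tabulate (h ∘ suc))

count-tabulate : ∀ {n} {A : Set} {P : A → Set} (P? : ∀ x → Dec (P x)) (h : Fin n → A) →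
                 count P? (tabulate h) ≡ sum (indicator ∘ P? ∘ h)
count-tabulate {zero}  P? h = refl
count-tabulate {suc n} P? h with P? (h zero)
... | yes _ = cong suc (count-tabulate P? (h ∘ suc))
... | no _  = count-tabulate P? (h ∘ suc)

inversions-lookup : ∀ {n} (v : Vec (Fin n) n) → inversions v ≡ inversionsᶠ (lookup v)
inversions-lookup {n} v = trans (sum-tabulate λ c → count (λ d → (c <ᶠ? d) ×-dec (lookup v d <ᶠ? lookup v c)) (allFin n))
  (sum-cong-≗ λ c → count-tabulate (λ d → (c <ᶠ? d) ×-dec (lookup v d <ᶠ? lookup v c)) (λ d → d))

inversions-swapPos : ∀ {n} (v : Vec (Fin n) n) a b → inversions (swapPos v a b) ≡ inversionsᶠ (lookup v ∘ transpose a b)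
inversions-swapPos v a b = trans (inversions-lookup (swapPos v a b)) (inversionsᶠ-cong (lookup-swapPos v a b))

inversions-swap-ascent : ∀ {n} (v : Vec (Fin n) n) {a b} → Adjacent a b → Ascent v a b →
                         inversions (swapPos v a b) ≡ suc (inversions v)
inversions-swap-ascent v {a} {b} ab asc = trans (inversions-swapPos v a b)
  (trans (inversionsᶠ-swap-ascent ab asc) (cong suc (sym (inversions-lookup v))))

inversions-swap-descent : ∀ {n} (v : Vec (Fin n) n) {a b} → Adjacent a b → Ascent v b a →
                          inversions v ≡ suc (inversions (swapPos v a b))
inversions-swap-descent v {a} {b} ab desc = trans (inversions-lookup v)
  (trans (inversionsᶠ-swap-adjacent-descent ab desc) (cong suc (sym (inversions-swapPos v a b))))

module _ {n} (v : Vec (Fin n) n) {j k : Fin n} (length-drop : inversions (swapPos v j k) + 1 ≡ inversions v) where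

  private
    exact : suc (inversionsᶠ (lookup v ∘ transpose j k)) ≡ inversionsᶠ (lookup v)
    exact = trans (cong suc (sym (inversions-swapPos v j k))) (trans (+-comm 1 _) (trans length-drop (inversions-lookup v)))

  length-drop⇒descent : j <ᶠ k → Ascent v k j
  length-drop⇒descent j<k = inversionsᶠ-swap-decrease⇒descent j<k (≤-reflexive exact)

  length-drop⇒¬over-middle : ∀ {q} → j <ᶠ q → q <ᶠ k → ¬ (Ascent v k q × Ascent v q j)
  length-drop⇒¬over-middle j<q q<k (vk<vq , vq<vj) =
    <-irrefl refl (<-trans (n<1+n (suc X)) (subst (2 + X <_) (sym exact) (inversionsᶠ-swap-over-middle j<q q<k vk<vq vq<vj)))
    where X = inversionsᶠ (lookup v ∘ transpose j k)

multiplicity : ∀ {n} → Vec (Fin n) n → Fin n → ℕ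
multiplicity v k = sum λ c → indicator (k ≟ lookup v c)

count-multiplicity : ∀ {n} (v : Vec (Fin n) n) k → count (k ≟_) v ≡ multiplicity v k
count-multiplicity v k = trans (cong (count (k ≟_)) (sym (tabulate∘lookup v))) (count-tabulate (k ≟_) (lookup v))

T-all⁻ : ∀ {n m} (P : Fin m → Bool) (h : Fin n → Fin m) →
         T (foldr _ (λ k b → P k ∧ b) true (tabulate h)) → ∀ i → T (P (h i))
T-all⁻ P h t zero    = proj₁ (Equivalence.to T-∧ t)
T-all⁻ P h t (suc i) = T-all⁻ P (h ∘ suc) (proj₂ (Equivalence.to T-∧ t)) i

T-all⁺ : ∀ {n m} (P : Fin m → Bool) (h : Fin n → Fin m) →
         (∀ i → T (P (h i))) → T (foldr _ (λ k b → P k ∧ b) true (tabulate h))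
T-all⁺ {zero}  P h _   = tt
T-all⁺ {suc n} P h all = Equivalence.from T-∧ (all zero , T-all⁺ P (h ∘ suc) (all ∘ suc))

isPerm⇒multiplicity≡1 : ∀ {n} (v : Vec (Fin n) n) → IsPerm v → ∀ k → multiplicity v k ≡ 1
isPerm⇒multiplicity≡1 v perm k =
  trans (sym (count-multiplicity v k)) (≡ᵇ⇒≡ _ 1 (T-all⁻ (λ k → count (k ≟_) v ≡ᵇ 1) (λ k → k) perm k))

multiplicity≡1⇒isPerm : ∀ {n} (v : Vec (Fin n) n) → (∀ k → multiplicity v k ≡ 1) → IsPerm v
multiplicity≡1⇒isPerm v once =
  T-all⁺ (λ k → count (k ≟_) v ≡ᵇ 1) (λ k → k) λ k → ≡⇒≡ᵇ _ 1 (trans (count-multiplicity v k) (once k))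

isPerm-swapPos : ∀ {n} (v : Vec (Fin n) n) a b → IsPerm v → IsPerm (swapPos v a b)
isPerm-swapPos v a b perm = multiplicity≡1⇒isPerm (swapPos v a b) λ k →
  trans (sum-cong-≗ {x = λ c → indicator (k ≟ lookup (swapPos v a b) c)} λ c →
           cong (indicator ∘ (k ≟_)) (lookup-swapPos v a b c))
        (trans (sum-transpose a b (λ c → indicator (k ≟ lookup v c))) (isPerm⇒multiplicity≡1 v perm k))

isPerm-injective : ∀ {n} (v : Vec (Fin n) n) → IsPerm v → ∀ {p q} → lookup v p ≡ lookup v q → p ≡ q
isPerm-injective v perm {p} {q} vp≡vq with p ≟ q
... | yes p≡q = p≡q
... | no p≢q  = ⊥-elim (<-irrefl (sym (isPerm⇒multiplicity≡1 v perm (lookup v p)))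
                  (subst₂ (λ x y → x + y ≤ multiplicity v (lookup v p))
                          (indicator-yes (lookup v p ≟ lookup v p) refl) (indicator-yes (lookup v p ≟ lookup v q) vp≡vq)
                    (+-≤-sum (λ c → indicator (lookup v p ≟ lookup v c)) p≢q)))

isPerm-ascent-or-descent : ∀ {n} (π : Vec (Fin n) n) → IsPerm π → ∀ {a b} → a ≢ b → Ascent π a b ⊎ Ascent π b a
isPerm-ascent-or-descent π perm {a} {b} a≢b with <-cmp (toℕ (lookup π a)) (toℕ (lookup π b))
... | tri< πa<πb _ _ = inj₁ πa<πb
... | tri≈ _ πa≡πb _ = ⊥-elim (a≢b (isPerm-injective π perm (toℕ-injective πa≡πb)))
... | tri> _ _ πb<πa = inj₂ πb<πa

lookup-idPerm : ∀ {n} (c : Fin n) → lookup (idPerm n) c ≡ c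
lookup-idPerm = lookup∘tabulate (λ c → c)

idPerm-ascent : ∀ {n} {a b : Fin n} → a <ᶠ b → Ascent (idPerm n) a b
idPerm-ascent {a = a} {b} = subst₂ _<ᶠ_ (sym (lookup-idPerm a)) (sym (lookup-idPerm b))

lookup-sPerm : ∀ {n} (a b c : Fin n) → lookup (sPerm a b) c ≡ transpose a b c
lookup-sPerm {n} a b c = trans (lookup-swapPos (idPerm n) a b c) (lookup-idPerm _)

sPerm-descent : ∀ {n} {a b : Fin n} → a <ᶠ b → Ascent (sPerm a b) b a
sPerm-descent {a = a} {b} = subst₂ _<ᶠ_ (sym (trans (lookup-sPerm a b b) (transpose-matchʳ a b)))
                                        (sym (trans (lookup-sPerm a b a) (transpose-matchˡ a b)))

sPerm-ascent : ∀ {n} {a b c d : Fin n} → Adjacent a b → c ≢ a → c <ᶠ d → Ascent (sPerm a b) c d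
sPerm-ascent {a = a} {b} {c} {d} ab c≢a c<d = subst₂ _<ᶠ_ (sym (lookup-sPerm a b c)) (sym (lookup-sPerm a b d))
  (transpose-adjacent-< ab (c≢a ∘ proj₁) (λ (c≡b , d≡a) → <-asym (subst₂ _<ᶠ_ c≡b d≡a c<d) (adjacent-< ab)) c<d)

complement : ∀ {n} → Vec (Fin n) n → Vec (Fin n) n
complement π = tabulate (opposite ∘ lookup π)

lookup-complement : ∀ {n} (π : Vec (Fin n) n) c → lookup (complement π) c ≡ opposite (lookup π c)
lookup-complement π = lookup∘tabulate (opposite ∘ lookup π)

opposite-< : ∀ {n} {x y : Fin n} → x <ᶠ y → opposite y <ᶠ opposite x
opposite-< {x = x} {y} x<y = subst₂ _<_ (sym (opposite-prop y)) (sym (opposite-prop x)) (∸-monoʳ-< (s≤s x<y) (toℕ<n y))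

opposite-≤ : ∀ {n} {x y : Fin n} → x ≤ᶠ y → opposite y ≤ᶠ opposite x
opposite-≤ {n} {x} {y} x≤y = subst₂ _≤_ (sym (opposite-prop y)) (sym (opposite-prop x)) (∸-monoʳ-≤ n (s≤s x≤y))

opposite-adjacent : ∀ {n} {a b : Fin n} → Adjacent a b → Adjacent (opposite b) (opposite a)
opposite-adjacent {n} {a} {b} ab = begin
  suc (toℕ (opposite b))  ≡⟨ cong suc (opposite-prop b) ⟩
  suc (n ∸ suc (toℕ b))   ≡⟨ +-∸-assoc 1 (toℕ<n b) ⟨
  n ∸ toℕ b               ≡⟨ cong (n ∸_) ab ⟨
  n ∸ suc (toℕ a)         ≡⟨ opposite-prop a ⟨
  toℕ (opposite a)        ∎
  where open ≡-Reasoning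

complement-ascent : ∀ {n} (π : Vec (Fin n) n) {a b} → Ascent π b a → Ascent (complement π) a b
complement-ascent π {a} {b} πb<πa = subst₂ _<ᶠ_ (sym (lookup-complement π a)) (sym (lookup-complement π b)) (opposite-< πb<πa)

complement-ascent⁻ : ∀ {n} (π : Vec (Fin n) n) {a b} → Ascent (complement π) a b → Ascent π b a
complement-ascent⁻ π {a} {b} asc = subst₂ _<ᶠ_ (opposite-involutive _) (opposite-involutive _)
  (opposite-< (subst₂ _<ᶠ_ (lookup-complement π a) (lookup-complement π b) asc))

complement-swapPos : ∀ {n} (π : Vec (Fin n) n) a b → complement (swapPos π a b) ≡ swapPos (complement π) a b
complement-swapPos π a b = ≗⇒≡ λ c → begin
  lookup (complement (swapPos π a b)) c  ≡⟨ lookup-complement (swapPos π a b) c ⟩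
  opposite (lookup (swapPos π a b) c)    ≡⟨ cong opposite (lookup-swapPos π a b c) ⟩
  opposite (lookup π (transpose a b c))  ≡⟨ lookup-complement π _ ⟨
  lookup (complement π) (transpose a b c) ≡⟨ lookup-swapPos (complement π) a b c ⟨
  lookup (swapPos (complement π) a b) c  ∎
  where open ≡-Reasoning

isPerm-complement : ∀ {n} (π : Vec (Fin n) n) → IsPerm π → IsPerm (complement π)
isPerm-complement π perm = multiplicity≡1⇒isPerm (complement π) λ k →
  trans (sum-cong-≗ {x = λ c → indicator (k ≟ lookup (complement π) c)} λ c →
           trans (cong (indicator ∘ (k ≟_)) (lookup-complement π c))
                 (indicator-cong _ _ (λ k≡ → trans (cong opposite k≡) (opposite-involutive _))
                                     (λ k≡ → trans (sym (opposite-involutive k)) (cong opposite k≡))))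
        (isPerm⇒multiplicity≡1 π perm (opposite k))

complement-idPerm : ∀ n → complement (idPerm n) ≡ w₀ n
complement-idPerm n = tabulate-cong (cong opposite ∘ lookup-idPerm)

ascending⇒≥ : ∀ {n} {g : Fin n → Fin n} → (∀ {a b} → Adjacent a b → g a <ᶠ g b) → ∀ c → c ≤ᶠ g c
ascending⇒≥ {n} {g} ascending c = from (toℕ c) c refl
  where
  from : ∀ t c → toℕ c ≡ t → t ≤ toℕ (g c)
  from zero    _ _   = z≤n
  from (suc t) c c≡t = ≤-trans (s≤s (from t p (toℕ-fromℕ< t<n))) (ascending (trans (cong suc (toℕ-fromℕ< t<n)) (sym c≡t)))
    where
    t<n : t < n
    t<n = <-trans (n<1+n t) (subst (_< n) c≡t (toℕ<n c))
    p = fromℕ< t<n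

-- The upper bound is the lower bound for the conjugate opposite ∘ g ∘ opposite.
ascending⇒≗id : ∀ {n} {g : Fin n → Fin n} → (∀ {a b} → Adjacent a b → g a <ᶠ g b) → ∀ c → g c ≡ c
ascending⇒≗id {g = g} ascending c = toℕ-injective (≤-antisym g≤id (ascending⇒≥ ascending c))
  where
  conjugate-ascending : ∀ {a b} → Adjacent a b → opposite (g (opposite a)) <ᶠ opposite (g (opposite b))
  conjugate-ascending ab = opposite-< (ascending (opposite-adjacent ab))
  g≤id : g c ≤ᶠ c
  g≤id = subst₂ _≤ᶠ_ (opposite-involutive (g c)) (opposite-involutive c)
           (opposite-≤ (subst (λ x → opposite c ≤ᶠ opposite (g x)) (opposite-involutive c)
             (ascending⇒≥ conjugate-ascending (opposite c))))

Descent : ∀ {n} → Vec (Fin n) n → Set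
Descent π = ∃[ a ] ∃[ b ] Adjacent a b × Ascent π b a

descent? : ∀ {n} (π : Vec (Fin n) n) → Dec (Descent π)
descent? π = any? λ a → any? λ b → (suc (toℕ a) ℕ.≟ toℕ b) ×-dec (lookup π b <ᶠ? lookup π a)

isPerm-¬descent⇒≡id : ∀ {n} (π : Vec (Fin n) n) → IsPerm π → ¬ Descent π → π ≡ idPerm n
isPerm-¬descent⇒≡id {n} π perm no-descent =
  ≗⇒≡ λ c → trans (ascending⇒≗id ascending c) (sym (lookup∘tabulate (λ c → c) c))
  where
  ascending : ∀ {a b} → Adjacent a b → Ascent π a b
  ascending {a} {b} ab with isPerm-ascent-or-descent π perm (adjacent-≢ ab)
  ... | inj₁ asc  = asc
  ... | inj₂ desc = ⊥-elim (no-descent (a , b , ab , desc))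

OppositeAt : ∀ {n} → Vec (Fin n) n → Vec (Fin n) n → Fin n → Fin n → Set
OppositeAt x z a b = (Ascent x b a × Ascent z a b) ⊎ (Ascent x a b × Ascent z b a)

inversions-swap-opposite : ∀ {n} (x z : Vec (Fin n) n) {a b} → Adjacent a b → OppositeAt x z a b →
                           inversions (swapPos x a b) + inversions (swapPos z a b) ≡ inversions x + inversions z
inversions-swap-opposite x z {a} {b} ab (inj₁ (x-desc , z-asc)) = begin
  inversions (swapPos x a b) + inversions (swapPos z a b)  ≡⟨ cong (_ +_) (inversions-swap-ascent z ab z-asc) ⟩
  inversions (swapPos x a b) + suc (inversions z)          ≡⟨ +-suc _ _ ⟩
  suc (inversions (swapPos x a b)) + inversions z          ≡⟨ cong (_+ _) (inversions-swap-descent x ab x-desc) ⟨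
  inversions x + inversions z                              ∎
  where open ≡-Reasoning
inversions-swap-opposite x z {a} {b} ab (inj₂ (x-asc , z-desc)) = begin
  inversions (swapPos x a b) + inversions (swapPos z a b)  ≡⟨ cong (_+ _) (inversions-swap-ascent x ab x-asc) ⟩
  suc (inversions x) + inversions (swapPos z a b)          ≡⟨ +-suc _ _ ⟨
  inversions x + suc (inversions (swapPos z a b))          ≡⟨ cong (_ +_) (inversions-swap-descent z ab z-desc) ⟨
  inversions x + inversions z                              ∎
  where open ≡-Reasoning

SameOrderAt : ∀ {n} → Vec (Fin n) n → Vec (Fin n) n → Fin n → Fin n → Set
SameOrderAt g h c d = (Ascent g c d × Ascent h c d) ⊎ (Ascent g d c × Ascent h d c)

inversions-swap-same-order : ∀ {n} (g h : Vec (Fin n) n) {c d} → Adjacent c d → SameOrderAt g h c d →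
                             inversions (swapPos g c d) + inversions h ≡ inversions (swapPos h c d) + inversions g
inversions-swap-same-order g h {c} {d} cd (inj₁ (g-asc , h-asc)) = begin
  inversions (swapPos g c d) + inversions h  ≡⟨ cong (_+ inversions h) (inversions-swap-ascent g cd g-asc) ⟩
  suc (inversions g + inversions h)          ≡⟨ cong suc (+-comm (inversions g) (inversions h)) ⟩
  suc (inversions h + inversions g)          ≡⟨ cong (_+ inversions g) (inversions-swap-ascent h cd h-asc) ⟨
  inversions (swapPos h c d) + inversions g  ∎
  where open ≡-Reasoning
inversions-swap-same-order g h {c} {d} cd (inj₂ (g-desc , h-desc)) = begin
  G′ + inversions h  ≡⟨ cong (G′ +_) (inversions-swap-descent h cd h-desc) ⟩
  G′ + suc H′        ≡⟨ +-suc G′ H′ ⟩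
  suc (G′ + H′)      ≡⟨ cong suc (+-comm G′ H′) ⟩
  suc (H′ + G′)      ≡⟨ +-suc H′ G′ ⟨
  H′ + suc G′        ≡⟨ cong (H′ +_) (inversions-swap-descent g cd g-desc) ⟨
  H′ + inversions g  ∎
  where
  open ≡-Reasoning
  G′ = inversions (swapPos g c d)
  H′ = inversions (swapPos h c d)

length-drop-swap : ∀ {n} (g : Vec (Fin n) n) {j k c d} → Adjacent c d → SameOrderAt g (swapPos g j k) c d →
                   inversions (swapPos g j k) + 1 ≡ inversions g →
                   inversions (swapPos (swapPos g j k) c d) + 1 ≡ inversions (swapPos g c d)
length-drop-swap g {j} {k} {c} {d} cd same length-drop = sym (+-cancelʳ-≡ (inversions σ) _ _ (begin
  inversions (swapPos g c d) + inversions σ       ≡⟨ inversions-swap-same-order g σ cd same ⟩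
  inversions (swapPos σ c d) + inversions g       ≡⟨ cong (inversions (swapPos σ c d) +_) length-drop ⟨
  inversions (swapPos σ c d) + (inversions σ + 1) ≡⟨ x∙yz≈xz∙y (inversions (swapPos σ c d)) (inversions σ) 1 ⟩
  inversions (swapPos σ c d) + 1 + inversions σ   ∎))
  where
  open ≡-Reasoning
  σ = swapPos g j k

module _ {n} (g : Vec (Fin n) n) (perm : IsPerm g) {j k : Fin n} (descent : Ascent g k j) where

  same-order-left : ∀ {q} → Adjacent j q → q <ᶠ k → ¬ (Ascent g k q × Ascent g q j) →
                    SameOrderAt g (swapPos g j k) j q
  same-order-left {q} jq q<k no-middle =
    cases (isPerm-ascent-or-descent g perm (adjacent-≢ jq)) (isPerm-ascent-or-descent g perm (<ᶠ⇒≢ q<k))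
    where
    σj = lookup-swapPos-matchˡ g j k
    σq = lookup-swapPos-other g (adjacent-≢ jq ∘ sym) (<ᶠ⇒≢ q<k)
    cases : Ascent g j q ⊎ Ascent g q j → Ascent g q k ⊎ Ascent g k q → SameOrderAt g (swapPos g j k) j q
    cases (inj₁ gj<gq) _            = inj₁ (gj<gq , subst₂ _<ᶠ_ (sym σj) (sym σq) (<-trans descent gj<gq))
    cases (inj₂ gq<gj) (inj₁ gq<gk) = inj₂ (gq<gj , subst₂ _<ᶠ_ (sym σq) (sym σj) gq<gk)
    cases (inj₂ gq<gj) (inj₂ gk<gq) = ⊥-elim (no-middle (gk<gq , gq<gj))

  same-order-right : ∀ {r} → j <ᶠ r → Adjacent r k → ¬ (Ascent g k r × Ascent g r j) →
                     SameOrderAt g (swapPos g j k) r k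
  same-order-right {r} j<r rk no-middle =
    cases (isPerm-ascent-or-descent g perm (adjacent-≢ rk)) (isPerm-ascent-or-descent g perm (<ᶠ⇒≢ j<r))
    where
    σk = lookup-swapPos-matchʳ g j k
    σr = lookup-swapPos-other g (<ᶠ⇒≢ j<r ∘ sym) (adjacent-≢ rk)
    cases : Ascent g r k ⊎ Ascent g k r → Ascent g j r ⊎ Ascent g r j → SameOrderAt g (swapPos g j k) r k
    cases (inj₁ gr<gk) _            = inj₁ (gr<gk , subst₂ _<ᶠ_ (sym σr) (sym σk) (<-trans gr<gk descent))
    cases (inj₂ gk<gr) (inj₁ gj<gr) = inj₂ (gk<gr , subst₂ _<ᶠ_ (sym σk) (sym σr) gj<gr)
    cases (inj₂ gk<gr) (inj₂ gr<gj) = ⊥-elim (no-middle (gk<gr , gr<gj))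

module _ {n : ℕ} (f : SchubertProblem n → ℤ) where

  DescentCyclingInvariant : Set
  DescentCyclingInvariant =
    (x y z : Vec (Fin n) n) → IsPerm x → IsPerm y → IsPerm z →
    inversions x + inversions y + inversions z + 1 ≡ n C 2 →
    (a b : Fin n) → suc (toℕ a) ≡ toℕ b →
    Ascent x a b → Ascent y a b → Ascent z a b →
    (t₁ t₂ t₃ : SchubertProblem n) →
    u t₁ ≡ swapPos x a b → v t₁ ≡ y → w t₁ ≡ z →
    u t₂ ≡ x → v t₂ ≡ swapPos y a b → w t₂ ≡ z →
    u t₃ ≡ x → v t₃ ≡ y → w t₃ ≡ swapPos z a b →
    (f t₁ ≡ f t₂) × (f t₂ ≡ f t₃)

  VanishesOnDcTrivial : Set
  VanishesOnDcTrivial = (t : SchubertProblem n) → (a b : Fin n) → suc (toℕ a) ≡ toℕ b →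
    Ascent (u t) a b → Ascent (v t) a b → Ascent (w t) a b → f t ≡ 0ℤ

  Normalised : Set
  Normalised = (t : SchubertProblem n) → u t ≡ idPerm n → v t ≡ idPerm n → w t ≡ w₀ n → f t ≡ 1ℤ

swap-u-w : ∀ {n} (t : SchubertProblem n) {a b : Fin n} → Adjacent a b → OppositeAt (u t) (w t) a b → SchubertProblem n
swap-u-w {n} t {a} {b} ab opposite-uw =
  sp (swapPos (u t) a b) (v t) (swapPos (w t) a b)
     (isPerm-swapPos (u t) a b (u-perm t)) (v-perm t) (isPerm-swapPos (w t) a b (w-perm t)) length
  where
  open ≡-Reasoning
  U = inversions (u t); V = inversions (v t); W = inversions (w t)
  U′ = inversions (swapPos (u t) a b); W′ = inversions (swapPos (w t) a b)
  length : U′ + V + W′ ≡ n C 2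
  length = begin
    U′ + V + W′  ≡⟨ xy∙z≈xz∙y U′ V W′ ⟩
    U′ + W′ + V  ≡⟨ cong (_+ V) (inversions-swap-opposite (u t) (w t) ab opposite-uw) ⟩
    U + W + V    ≡⟨ xy∙z≈xz∙y U W V ⟩
    U + V + W    ≡⟨ length-sum t ⟩
    n C 2        ∎

swap-v-w : ∀ {n} (t : SchubertProblem n) {a b : Fin n} → Adjacent a b → OppositeAt (v t) (w t) a b → SchubertProblem n
swap-v-w {n} t {a} {b} ab opposite-vw =
  sp (u t) (swapPos (v t) a b) (swapPos (w t) a b)
     (u-perm t) (isPerm-swapPos (v t) a b (v-perm t)) (isPerm-swapPos (w t) a b (w-perm t)) length
  where
  open ≡-Reasoning
  U = inversions (u t); V = inversions (v t); W = inversions (w t)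
  V′ = inversions (swapPos (v t) a b); W′ = inversions (swapPos (w t) a b)
  length : U + V′ + W′ ≡ n C 2
  length = begin
    U + V′ + W′    ≡⟨ +-assoc U V′ W′ ⟩
    U + (V′ + W′)  ≡⟨ cong (U +_) (inversions-swap-opposite (v t) (w t) ab opposite-vw) ⟩
    U + (V + W)    ≡⟨ +-assoc U V W ⟨
    U + V + W      ≡⟨ length-sum t ⟩
    n C 2          ∎

module DescentCycling {n} {f : SchubertProblem n → ℤ} (cycling : DescentCyclingInvariant f) where

  module _ {x y z : Vec (Fin n) n} (px : IsPerm x) (py : IsPerm y) (pz : IsPerm z)
           {a b : Fin n} (ab : Adjacent a b) (x-asc : Ascent x a b) (y-asc : Ascent y a b) (z-asc : Ascent z a b)
           (length : inversions x + inversions y + inversions z + 1 ≡ n C 2) where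

    cycle-u-w : (t₁ t₃ : SchubertProblem n) → u t₁ ≡ swapPos x a b → v t₁ ≡ y → w t₁ ≡ z →
                u t₃ ≡ x → v t₃ ≡ y → w t₃ ≡ swapPos z a b → f t₁ ≡ f t₃
    cycle-u-w t₁ t₃ u₁ v₁ w₁ u₃ v₃ w₃ = trans (proj₁ steps) (proj₂ steps)
      where
      middle : SchubertProblem n
      middle = sp x (swapPos y a b) z px (isPerm-swapPos y a b py) pz
        (trans (cong (_+ inversions z) (trans (cong (inversions x +_) (inversions-swap-ascent y ab y-asc)) (+-suc _ _)))
               (trans (+-comm 1 _) length))
      steps = cycling x y z px py pz length a b ab x-asc y-asc z-asc t₁ middle t₃ u₁ v₁ w₁ refl refl refl u₃ v₃ w₃

    cycle-v-w : (t₂ t₃ : SchubertProblem n) → u t₂ ≡ x → v t₂ ≡ swapPos y a b → w t₂ ≡ z →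
                u t₃ ≡ x → v t₃ ≡ y → w t₃ ≡ swapPos z a b → f t₂ ≡ f t₃
    cycle-v-w t₂ t₃ u₂ v₂ w₂ u₃ v₃ w₃ =
      proj₂ (cycling x y z px py pz length a b ab x-asc y-asc z-asc left t₂ t₃ refl refl refl u₂ v₂ w₂ u₃ v₃ w₃)
      where
      left : SchubertProblem n
      left = sp (swapPos x a b) y z (isPerm-swapPos x a b px) py pz
        (trans (cong (λ m → m + inversions y + inversions z) (inversions-swap-ascent x ab x-asc)) (trans (+-comm 1 _) length))

  module _ (t : SchubertProblem n) {a b : Fin n} (ab : Adjacent a b) where
    private
      U = inversions (u t); V = inversions (v t); W = inversions (w t)

      length-u : Ascent (u t) b a → inversions (swapPos (u t) a b) + V + W + 1 ≡ n C 2
      length-u u-desc = trans (+-comm _ 1)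
        (trans (cong (λ m → m + V + W) (sym (inversions-swap-descent (u t) ab u-desc))) (length-sum t))

      length-v : Ascent (v t) b a → U + inversions (swapPos (v t) a b) + W + 1 ≡ n C 2
      length-v v-desc = trans (+-comm _ 1) (trans (cong (_+ W) (sym (+-suc U _)))
        (trans (cong (λ m → U + m + W) (sym (inversions-swap-descent (v t) ab v-desc))) (length-sum t)))

      length-w : Ascent (w t) b a → U + V + inversions (swapPos (w t) a b) + 1 ≡ n C 2
      length-w w-desc = trans (+-comm _ 1) (trans (sym (+-suc (U + V) _))
        (trans (cong (U + V +_) (sym (inversions-swap-descent (w t) ab w-desc))) (length-sum t)))

    swap-u-w-invariant : Ascent (v t) a b → (opposite-uw : OppositeAt (u t) (w t) a b) →
                         f (swap-u-w t ab opposite-uw) ≡ f t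
    swap-u-w-invariant v-asc opposite-uw@(inj₁ (u-desc , w-asc)) =
      sym (cycle-u-w (isPerm-swapPos (u t) a b (u-perm t)) (v-perm t) (w-perm t) ab
                     (swapPos-ascent (u t) u-desc) v-asc w-asc (length-u u-desc)
                     t (swap-u-w t ab opposite-uw) (sym (swapPos-involutive (u t) a b)) refl refl refl refl refl)
    swap-u-w-invariant v-asc opposite-uw@(inj₂ (u-asc , w-desc)) =
      cycle-u-w (u-perm t) (v-perm t) (isPerm-swapPos (w t) a b (w-perm t)) ab
                u-asc v-asc (swapPos-ascent (w t) w-desc) (length-w w-desc)
                (swap-u-w t ab opposite-uw) t refl refl refl refl refl (sym (swapPos-involutive (w t) a b))

    swap-v-w-invariant : Ascent (u t) a b → (opposite-vw : OppositeAt (v t) (w t) a b) →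
                         f (swap-v-w t ab opposite-vw) ≡ f t
    swap-v-w-invariant u-asc opposite-vw@(inj₁ (v-desc , w-asc)) =
      sym (cycle-v-w (u-perm t) (isPerm-swapPos (v t) a b (v-perm t)) (w-perm t) ab
                     u-asc (swapPos-ascent (v t) v-desc) w-asc (length-v v-desc)
                     t (swap-v-w t ab opposite-vw) refl (sym (swapPos-involutive (v t) a b)) refl refl refl refl)
    swap-v-w-invariant u-asc opposite-vw@(inj₂ (v-asc , w-desc)) =
      cycle-v-w (u-perm t) (v-perm t) (isPerm-swapPos (w t) a b (w-perm t)) ab
                u-asc v-asc (swapPos-ascent (w t) w-desc) (length-w w-desc)
                (swap-v-w t ab opposite-vw) t refl refl refl refl refl (sym (swapPos-involutive (w t) a b))

module _ {n} {f : SchubertProblem n → ℤ} (cycling : DescentCyclingInvariant f) (normalised : Normalised f) where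
  open DescentCycling cycling

  f-id-complement : (π : Vec (Fin n) n) → IsPerm π → (t : SchubertProblem n) →
                    u t ≡ π → v t ≡ idPerm n → w t ≡ complement π → f t ≡ 1ℤ
  f-id-complement π perm = by-length π perm (<-wellFounded (inversions π))
    where
    by-length : ∀ π → IsPerm π → Acc _<_ (inversions π) → ∀ t →
                u t ≡ π → v t ≡ idPerm n → w t ≡ complement π → f t ≡ 1ℤ
    by-length π perm (acc shorter) t u≡π v≡id w≡πᶜ with descent? π
    ... | no no-descent = normalised t (trans u≡π π≡id) v≡id
                            (trans w≡πᶜ (trans (cong complement π≡id) (complement-idPerm n)))
      where π≡id = isPerm-¬descent⇒≡id π perm no-descent
    ... | yes (a , b , ab , π-desc) = begin
      f t   ≡⟨ swap-u-w-invariant t ab (ascent-≡ v≡id (idPerm-ascent (adjacent-< ab))) opposite-uw ⟨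
      f t′  ≡⟨ by-length π′ (isPerm-swapPos π a b perm) (shorter (≤-reflexive (sym (inversions-swap-descent π ab π-desc))))
                 t′ (cong (λ x → swapPos x a b) u≡π) v≡id
                 (trans (cong (λ x → swapPos x a b) w≡πᶜ) (sym (complement-swapPos π a b))) ⟩
      1ℤ    ∎
      where
      open ≡-Reasoning
      π′ = swapPos π a b
      opposite-uw : OppositeAt (u t) (w t) a b
      opposite-uw = inj₁ (ascent-≡ u≡π π-desc , ascent-≡ w≡πᶜ (complement-ascent π π-desc))
      t′ = swap-u-w t ab opposite-uw

module Monk {n} {f : SchubertProblem n → ℤ} (cycling : DescentCyclingInvariant f)
            (vanishes : VanishesOnDcTrivial f) (normalised : Normalised f)
            {a b : Fin n} (ab : Adjacent a b) where
  open DescentCycling cycling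

  Between : Fin n → Fin n → Set
  Between j k = j ≤ᶠ a × a <ᶠ k

  HasMonkValue : SchubertProblem n → Fin n → Fin n → Set
  HasMonkValue t j k = (Between j k → f t ≡ 1ℤ) × (¬ Between j k → f t ≡ 0ℤ)

  record MonkInstance (π : Vec (Fin n) n) (j k : Fin n) (t : SchubertProblem n) : Set where
    field
      π-perm      : IsPerm π
      length-drop : inversions (swapPos (complement π) j k) + 1 ≡ inversions (complement π)
      u≡π         : u t ≡ π
      v≡s         : v t ≡ sPerm a b
      w≡σ         : w t ≡ swapPos (complement π) j k

  shorten-interval : ∀ {π j k t} → MonkInstance π j k t → ∀ {c d j′ k′} → Adjacent c d → c ≢ a →
                     (∀ x → transpose j k (transpose c d x) ≡ transpose c d (transpose j′ k′ x)) →
                     SameOrderAt (complement π) (swapPos (complement π) j k) c d →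
                     (Between j k → Between j′ k′) → (Between j′ k′ → Between j k) →
                     (∀ {t′} → MonkInstance (swapPos π c d) j′ k′ t′ → HasMonkValue t′ j′ k′) →
                     HasMonkValue t j k
  shorten-interval {π} {j} {k} {t} inst {c} {d} {j′} {k′} cd c≢a slide same between⇒ between⇐ recurse =
      (λ between → trans f≡ (proj₁ value (between⇒ between)))
    , (λ ¬between → trans f≡ (proj₂ value (¬between ∘ between⇐)))
    where
    open MonkInstance inst
    σ′ = complement π
    σ = swapPos σ′ j k
    π′ = swapPos π c d

    opposite-uw : OppositeAt (u t) (w t) c d
    opposite-uw = ⊎-map
      (λ (σ′-asc , σ-asc)   → ascent-≡ u≡π (complement-ascent⁻ π σ′-asc) , ascent-≡ w≡σ σ-asc)
      (λ (σ′-desc , σ-desc) → ascent-≡ u≡π (complement-ascent⁻ π σ′-desc) , ascent-≡ w≡σ σ-desc) same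

    t′ = swap-u-w t cd opposite-uw

    f≡ : f t ≡ f t′
    f≡ = sym (swap-u-w-invariant t cd (ascent-≡ v≡s (sPerm-ascent ab c≢a (adjacent-< cd))) opposite-uw)

    swapped : swapPos (complement π′) j′ k′ ≡ swapPos σ c d
    swapped = trans (cong (λ y → swapPos y j′ k′) (complement-swapPos π c d)) (swapPos-slide σ′ slide)

    length-drop′ : inversions (swapPos (complement π′) j′ k′) + 1 ≡ inversions (complement π′)
    length-drop′ = subst₂ (λ y z → inversions y + 1 ≡ inversions z) (sym swapped) (sym (complement-swapPos π c d))
                          (length-drop-swap σ′ cd same length-drop)

    value : HasMonkValue t′ j′ k′
    value = recurse record
      { π-perm      = isPerm-swapPos π c d π-perm
      ; length-drop = length-drop′
      ; u≡π         = cong (λ y → swapPos y c d) u≡π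
      ; v≡s         = v≡s
      ; w≡σ         = trans (cong (λ y → swapPos y c d) w≡σ) (sym swapped)
      }

  monk-adjacent : ∀ {π j k t} → Adjacent j k → MonkInstance π j k t → HasMonkValue t j k
  monk-adjacent {π} {j} {k} {t} jk inst = base (j ≟ a)
    where
    open MonkInstance inst
    σ′ = complement π
    σ′-desc : Ascent σ′ k j
    σ′-desc = length-drop⇒descent σ′ length-drop (adjacent-< jk)
    π-asc : Ascent π j k
    π-asc = complement-ascent⁻ π σ′-desc
    σ-asc : Ascent (swapPos σ′ j k) j k
    σ-asc = swapPos-ascent σ′ σ′-desc
    base : Dec (j ≡ a) → HasMonkValue t j k
    base (yes refl) with adjacent-unique jk ab
    ... | refl = (λ _ → trans f≡ (f-id-complement cycling normalised π π-perm t′ u≡π v′≡id w′≡σ′))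
               , (λ ¬between → ⊥-elim (¬between (≤-refl , adjacent-< jk)))
      where
      opposite-vw : OppositeAt (v t) (w t) j k
      opposite-vw = inj₁ (ascent-≡ v≡s (sPerm-descent (adjacent-< jk)) , ascent-≡ w≡σ σ-asc)
      t′ = swap-v-w t jk opposite-vw
      f≡ : f t ≡ f t′
      f≡ = sym (swap-v-w-invariant t jk (ascent-≡ u≡π π-asc) opposite-vw)
      v′≡id : v t′ ≡ idPerm n
      v′≡id = trans (cong (λ y → swapPos y j k) v≡s) (swapPos-involutive (idPerm n) j k)
      w′≡σ′ : w t′ ≡ σ′
      w′≡σ′ = trans (cong (λ y → swapPos y j k) w≡σ) (swapPos-involutive σ′ j k)
    base (no j≢a) =
        (λ (j≤a , a<k) → ⊥-elim (j≢a (toℕ-injective (≤-antisym j≤a (≤-pred (subst (toℕ a <_) (sym jk) a<k))))))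
      , (λ _ → vanishes t j k jk (ascent-≡ u≡π π-asc) (ascent-≡ v≡s (sPerm-ascent ab j≢a (adjacent-< jk)))
                                 (ascent-≡ w≡σ σ-asc))

  shorten-left : ∀ {π j q k t} → j ≢ a → Adjacent j q → q <ᶠ k → MonkInstance π j k t →
                 (∀ {t′} → MonkInstance (swapPos π j q) q k t′ → HasMonkValue t′ q k) → HasMonkValue t j k
  shorten-left {π} {j} {q} {k} j≢a jq q<k inst =
    shorten-interval inst jq j≢a (transpose-slide (adjacent-≢ jq) (<ᶠ⇒≢ q<k) (<ᶠ⇒≢ j<k))
      (same-order-left σ′ (isPerm-complement π π-perm) (length-drop⇒descent σ′ length-drop j<k) jq q<k
        (length-drop⇒¬over-middle σ′ length-drop (adjacent-< jq) q<k))
      (λ (j≤a , a<k) → subst (_≤ toℕ a) jq (≤∧≢⇒< j≤a (j≢a ∘ toℕ-injective)) , a<k)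
      (λ (q≤a , a<k) → <⇒≤ (<-≤-trans (adjacent-< jq) q≤a) , a<k)
    where
    open MonkInstance inst
    σ′ = complement π
    j<k = <-trans (adjacent-< jq) q<k

  shorten-right : ∀ {π r k t} → a <ᶠ r → Adjacent r k → MonkInstance π a k t →
                  (∀ {t′} → MonkInstance (swapPos π r k) a r t′ → HasMonkValue t′ a r) → HasMonkValue t a k
  shorten-right {π} {r} {k} a<r rk inst =
    shorten-interval inst rk (<ᶠ⇒≢ a<r ∘ sym) slide
      (same-order-right σ′ (isPerm-complement π π-perm) (length-drop⇒descent σ′ length-drop a<k) a<r rk
        (length-drop⇒¬over-middle σ′ length-drop a<r (adjacent-< rk)))
      (λ (a≤a , _) → a≤a , a<r)
      (λ (a≤a , _) → a≤a , a<k)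
    where
    open MonkInstance inst
    open ≡-Reasoning
    σ′ = complement π
    a<k = <-trans a<r (adjacent-< rk)
    slide : ∀ x → transpose a k (transpose r k x) ≡ transpose r k (transpose a r x)
    slide x = begin
      transpose a k (transpose r k x)  ≡⟨ transpose-sym a k (transpose r k x) ⟩
      transpose k a (transpose r k x)  ≡⟨ cong (transpose k a) (transpose-sym r k x) ⟩
      transpose k a (transpose k r x)  ≡⟨ transpose-slide (adjacent-≢ rk ∘ sym) (<ᶠ⇒≢ a<r ∘ sym) (<ᶠ⇒≢ a<k ∘ sym) x ⟩
      transpose k r (transpose r a x)  ≡⟨ transpose-sym k r (transpose r a x) ⟩
      transpose r k (transpose r a x)  ≡⟨ cong (transpose r k) (transpose-sym r a x) ⟩
      transpose r k (transpose a r x)  ∎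

  monk-rule : ∀ d {π j k t} → toℕ k ≡ d + suc (toℕ j) → MonkInstance π j k t → HasMonkValue t j k
  monk-rule zero    k≡1+j   inst = monk-adjacent (sym k≡1+j) inst
  monk-rule (suc d) {j = j} {k} k≡d+2+j inst with j ≟ a
  ... | no j≢a = shorten-left j≢a jq (subst (_< toℕ k) jq 2+j≤k) inst
                   (monk-rule d (trans k≡d+2+j (trans (sym (+-suc d _)) (cong (λ m → d + suc m) jq))))
    where
    2+j≤k : suc (suc (toℕ j)) ≤ toℕ k
    2+j≤k = subst (_ ≤_) (sym k≡d+2+j) (s≤s (m≤n+m _ d))
    q = fromℕ< (<-trans 2+j≤k (toℕ<n k))
    jq : Adjacent j q
    jq = sym (toℕ-fromℕ< _)
  ... | yes refl = shorten-right (subst (toℕ a <_) (sym toℕr) (m≤n+m _ d)) (trans (cong suc toℕr) (sym k≡d+2+j)) inst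
                     (monk-rule d toℕr)
    where
    r<n : d + suc (toℕ a) < n
    r<n = <-trans (n<1+n _) (subst (_< n) k≡d+2+j (toℕ<n k))
    r = fromℕ< r<n
    toℕr : toℕ r ≡ d + suc (toℕ a)
    toℕr = toℕ-fromℕ< r<n

theorem1 : (n : ℕ) → 2 ≤ n → (f : SchubertProblem n → ℤ) →
    -- (1) invariance under descent-cycling
    ((x y z : Vec (Fin n) n) → IsPerm x → IsPerm y → IsPerm z →
      inversions x + inversions y + inversions z + 1 ≡ n C 2 →
      (a b : Fin n) → suc (toℕ a) ≡ toℕ b →
      Ascent x a b → Ascent y a b → Ascent z a b →
      (t₁ t₂ t₃ : SchubertProblem n) →
      u t₁ ≡ swapPos x a b → v t₁ ≡ y → w t₁ ≡ z →
      u t₂ ≡ x → v t₂ ≡ swapPos y a b → w t₂ ≡ z →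
      u t₃ ≡ x → v t₃ ≡ y → w t₃ ≡ swapPos z a b →
      (f t₁ ≡ f t₂) × (f t₂ ≡ f t₃)) →
    -- (2) vanishing on dc-trivial problems
    ((t : SchubertProblem n) → (a b : Fin n) → suc (toℕ a) ≡ toℕ b →
      Ascent (u t) a b → Ascent (v t) a b → Ascent (w t) a b → f t ≡ 0ℤ) →
    -- (3) normalisation f(id, id, w0) = 1
    ((t : SchubertProblem n) → u t ≡ idPerm n → v t ≡ idPerm n → w t ≡ w₀ n → f t ≡ 1ℤ) →
    -- conclusion: Monk's rule
    (π : Vec (Fin n) n) → IsPerm π →
    (j k : Fin n) → j <ᶠ k →
    let σ′ = tabulate (λ m → opposite (lookup π m)) in
    lookup σ′ k <ᶠ lookup σ′ j →
    inversions (swapPos σ′ j k) + 1 ≡ inversions σ′ →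
    (a b : Fin n) → suc (toℕ a) ≡ toℕ b →
    (t : SchubertProblem n) → u t ≡ π → v t ≡ sPerm a b → w t ≡ swapPos σ′ j k →
    ((j ≤ᶠ a × a <ᶠ k) → f t ≡ 1ℤ) × (¬ (j ≤ᶠ a × a <ᶠ k) → f t ≡ 0ℤ)
theorem1 n _ f cycling vanishes normalised π π-perm j k j<k _ length-drop a b ab t u≡π v≡s w≡σ =
  Monk.monk-rule cycling vanishes normalised ab (toℕ k ∸ suc (toℕ j)) (sym (m∸n+n≡m j<k))
    record { π-perm = π-perm ; length-drop = length-drop ; u≡π = u≡π ; v≡s = v≡s ; w≡σ = w≡σ }
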